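{- (a) For $i\ge0$ and $t\ge1$, let $c_{2i+1}(t)$ be the entry in row $i+t$ and column $2t$ of the binomial array $B(1-x^{2i+1})$, i.e. the coefficient of $x^{i+t}$ in $(1+x)^{2t}(1-x^{2i+1})$. Then $c_1(t)=C_t$, and for $i\ge1$, $$c_{2i+1}(t)=\frac{2i+1}{t+i+1}\binom{2t}{t-i}.$$ (b) For $i\ge1$ and $t\ge0$, let $c_{2i}(t)$ be the entry in row $i+t$ and column $2t+1$ of the binomial array $B(1-x^{2i})$, i.e. the coefficient of $x^{i+t}$ in $(1+x)^{2t+1}(1-x^{2i})$. Then $c_2(t)=C_{t+1}$, and for $i\ge1$, $$c_{2i}(t)=\frac{2i}{t+i+1}\binom{2t+1}{t-i+1}.$$ Here $C_j=\frac{1}{j+1}\binom{2j}{j}$ is the $j$-th Catalan number, and $\binom{n}{j}=0$ for $j<0$.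
   Context: The binomial array $B(p(x))$ has entries $a_{k,n}$ equal to the coefficient of $x^k$ in $(1+x)^np(x)$. In the paper, $c_{2i+1}(t)$ is described as the value immediately to the right of the zero in column $2t-1$ on the diagonal of zeros of $B(1-x^{2i+1})$, and $c_{2i}(t)$ as the value to the right of the zero in column $2t$ on the diagonal of zeros of $B(1-x^{2i})$. -}

module Defs where

open import Data.Nat using (ℕ; zero; suc; _*_; _/_)
open import Data.Nat.Combinatorics using (_C_)
open import Data.Integer as ℤ using (ℤ; +_; -[1+_])
open import Data.List using (List; []; _∷_; map; replicate; _++_)

-- Polynomials with integer coefficients as coefficient lists (constant term first).
Poly : Set
Poly = List ℤ

addP : Poly → Poly → Poly
addP [] q = q
addP p [] = p
addP (a ∷ p) (b ∷ q) = (a ℤ.+ b) ∷ addP p q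

mulP : Poly → Poly → Poly
mulP [] q = []
mulP (a ∷ p) q = addP (map (a ℤ.*_) q) (+ 0 ∷ mulP p q)

powP : Poly → ℕ → Poly
powP p zero = + 1 ∷ []
powP p (suc n) = mulP p (powP p n)

coeff : Poly → ℕ → ℤ
coeff [] k = + 0
coeff (a ∷ p) zero = a
coeff (a ∷ p) (suc k) = coeff p k

onePlusX : Poly
onePlusX = + 1 ∷ + 1 ∷ []

oneMinusXPow : ℕ → Poly
oneMinusXPow m = addP (+ 1 ∷ []) (replicate m (+ 0) ++ (-[1+ 0 ] ∷ []))

-- Entry a_{k,n} of the binomial array B(p): coefficient of x^k in (1+x)^n p(x).
binArray : Poly → ℕ → ℕ → ℤ
binArray p k n = coeff (mulP (powP onePlusX n) p) k

-- Binomial coefficient with integer lower index; zero for negative lower index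
-- (and, via stdlib's _C_, zero when the lower index exceeds n).
binomℤ : ℕ → ℤ → ℤ
binomℤ n (+ k) = + (n C k)
binomℤ n -[1+ _ ] = + 0

-- Catalan number C_j = binom(2j, j) / (j + 1)  (exact division)
catalan : ℕ → ℕ
catalan j = ((2 * j) C j) / suc j

-- Both parts are instances of one identity: if m + n = 2k + 1 then
-- (k + 1)·[xᵏ](1 + x)ⁿ(1 − xᵐ) = m·C(n, n − k).  The coefficient is C(n, k) − C(n, k − m).
-- If k < m only C(n, k) survives, and m + n = 2k + 1 forces n ≤ k, so both sides are 1 (n = k)
-- or 0 (n < k).  Otherwise k = m + j and n = k + j + 1, symmetry gives C(n, k) = C(n, j + 1),
-- and the identity becomes the absorption identity (j + 1)·C(n, j + 1) = (k + 1)·C(n, j).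
-- The Catalan cases are (m, n) = (1, 2t) and (2, 2t + 1), divided through by k + 1.
module Submission where

open import Defs
open import Data.Nat as ℕ using (ℕ; zero; suc; _+_; _*_; _<_; _≥_; _/_; s≤s)
open import Data.Nat.Properties as ℕ
  using (+-suc; <-cmp; m≤n⇒∃[o]m+o≡n; m≤m+n; m+n∸m≡n; +-cancelʳ-≡; +-cancelʳ-<)
open import Data.Nat.Combinatorics
  using (_C_; nCk+nC[k+1]≡[n+1]C[k+1]; nCk≡nC[n∸k]; nC1≡n; nCn≡1; k>n⇒nCk≡0)
open import Data.Nat.DivMod using (m*n/n≡m)
open import Data.Nat.Tactic.RingSolver as ℕ-Solver using ()
open import Data.Integer as ℤ using (ℤ; +_; -[1+_]; _⊖_)
open import Data.Integer.Properties as ℤ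
  using ( pos-+; pos-*; +-injective; [+m]-[+n]≡m⊖n; [1+m]⊖[1+n]≡m⊖n; ⊖-≥; n⊖n≡0
        ; +-cancelˡ-⊖; distribˡ-⊖-+-pos)
open import Data.Integer.Tactic.RingSolver as ℤ-Solver using ()
open import Data.List using ([]; _∷_; map; replicate; _++_)
open import Data.Product using (_×_; _,_)
open import Relation.Binary.PropositionalEquality
  using (_≡_; refl; sym; trans; cong; cong₂; subst; module ≡-Reasoning)
open import Relation.Binary.Definitions using (tri<; tri≈; tri>)

coeff-addP : ∀ p q k → coeff (addP p q) k ≡ coeff p k ℤ.+ coeff q k
coeff-addP []      q       k       = sym (ℤ.+-identityˡ _)
coeff-addP (a ∷ p) []      k       = sym (ℤ.+-identityʳ _)
coeff-addP (a ∷ p) (b ∷ q) zero    = refl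
coeff-addP (a ∷ p) (b ∷ q) (suc k) = coeff-addP p q k

coeff-map-* : ∀ a q k → coeff (map (a ℤ.*_) q) k ≡ a ℤ.* coeff q k
coeff-map-* a []      k       = sym (ℤ.*-zeroʳ a)
coeff-map-* a (b ∷ q) zero    = refl
coeff-map-* a (b ∷ q) (suc k) = coeff-map-* a q k

coeff-mulP-∷ˡ : ∀ a p q k →
  coeff (mulP (a ∷ p) q) k ≡ a ℤ.* coeff q k ℤ.+ coeff (+ 0 ∷ mulP p q) k
coeff-mulP-∷ˡ a p q k =
  trans (coeff-addP (map (a ℤ.*_) q) _ k) (cong (ℤ._+ _) (coeff-map-* a q k))

coeff-mulP-addPʳ : ∀ p q r k →
  coeff (mulP p (addP q r)) k ≡ coeff (mulP p q) k ℤ.+ coeff (mulP p r) k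
coeff-mulP-addPʳ []      q r k = refl
coeff-mulP-addPʳ (a ∷ p) q r k = begin
  coeff (mulP (a ∷ p) (addP q r)) k
    ≡⟨ coeff-mulP-∷ˡ a p (addP q r) k ⟩
  a ℤ.* coeff (addP q r) k ℤ.+ coeff (+ 0 ∷ mulP p (addP q r)) k
    ≡⟨ cong₂ (λ x y → a ℤ.* x ℤ.+ y) (coeff-addP q r k) (tail k) ⟩
  a ℤ.* (coeff q k ℤ.+ coeff r k) ℤ.+ (coeff (+ 0 ∷ mulP p q) k ℤ.+ coeff (+ 0 ∷ mulP p r) k)
    ≡⟨ regroup a (coeff q k) (coeff r k) _ _ ⟩
  (a ℤ.* coeff q k ℤ.+ coeff (+ 0 ∷ mulP p q) k) ℤ.+ (a ℤ.* coeff r k ℤ.+ coeff (+ 0 ∷ mulP p r) k)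
    ≡⟨ sym (cong₂ ℤ._+_ (coeff-mulP-∷ˡ a p q k) (coeff-mulP-∷ˡ a p r k)) ⟩
  coeff (mulP (a ∷ p) q) k ℤ.+ coeff (mulP (a ∷ p) r) k ∎
  where
  open ≡-Reasoning
  regroup : ∀ a x y u v → a ℤ.* (x ℤ.+ y) ℤ.+ (u ℤ.+ v) ≡ (a ℤ.* x ℤ.+ u) ℤ.+ (a ℤ.* y ℤ.+ v)
  regroup = ℤ-Solver.solve-∀
  tail : ∀ k →
    coeff (+ 0 ∷ mulP p (addP q r)) k ≡ coeff (+ 0 ∷ mulP p q) k ℤ.+ coeff (+ 0 ∷ mulP p r) k
  tail zero    = refl
  tail (suc k) = coeff-mulP-addPʳ p q r k

coeff-mulP-∷0ʳ : ∀ p q k → coeff (mulP p (+ 0 ∷ q)) k ≡ coeff (+ 0 ∷ mulP p q) k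
coeff-mulP-∷0ʳ []      q zero    = refl
coeff-mulP-∷0ʳ []      q (suc k) = refl
coeff-mulP-∷0ʳ (a ∷ p) q zero    = trans (ℤ.+-identityʳ (a ℤ.* + 0)) (ℤ.*-zeroʳ a)
coeff-mulP-∷0ʳ (a ∷ p) q (suc k) = begin
  coeff (addP (map (a ℤ.*_) q) (mulP p (+ 0 ∷ q))) k
    ≡⟨ coeff-addP (map (a ℤ.*_) q) _ k ⟩
  coeff (map (a ℤ.*_) q) k ℤ.+ coeff (mulP p (+ 0 ∷ q)) k
    ≡⟨ cong₂ ℤ._+_ (coeff-map-* a q k) (coeff-mulP-∷0ʳ p q k) ⟩
  a ℤ.* coeff q k ℤ.+ coeff (+ 0 ∷ mulP p q) k
    ≡⟨ sym (coeff-mulP-∷ˡ a p q k) ⟩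
  coeff (mulP (a ∷ p) q) k ∎
  where open ≡-Reasoning

coeff-mulP-padʳ-< : ∀ p q m k → k < m → coeff (mulP p (replicate m (+ 0) ++ q)) k ≡ + 0
coeff-mulP-padʳ-< p q (suc m) zero    _         = coeff-mulP-∷0ʳ p _ zero
coeff-mulP-padʳ-< p q (suc m) (suc k) (s≤s k<m) =
  trans (coeff-mulP-∷0ʳ p _ (suc k)) (coeff-mulP-padʳ-< p q m k k<m)

coeff-mulP-padʳ-+ : ∀ p q m j → coeff (mulP p (replicate m (+ 0) ++ q)) (m + j) ≡ coeff (mulP p q) j
coeff-mulP-padʳ-+ p q zero    j = refl
coeff-mulP-padʳ-+ p q (suc m) j =
  trans (coeff-mulP-∷0ʳ p _ (suc m + j)) (coeff-mulP-padʳ-+ p q m j)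

coeff-mulP-constʳ : ∀ p c k → coeff (mulP p (c ∷ [])) k ≡ coeff p k ℤ.* c
coeff-mulP-constʳ []      c k       = sym (ℤ.*-zeroˡ c)
coeff-mulP-constʳ (a ∷ p) c zero    = ℤ.+-identityʳ (a ℤ.* c)
coeff-mulP-constʳ (a ∷ p) c (suc k) = coeff-mulP-constʳ p c k

coeff-mulP-constˡ : ∀ c q k → coeff (mulP (c ∷ []) q) k ≡ c ℤ.* coeff q k
coeff-mulP-constˡ c q k =
  trans (coeff-mulP-∷ˡ c [] q k)
        (trans (cong (λ z → c ℤ.* coeff q k ℤ.+ z) (zero-tail k)) (ℤ.+-identityʳ _))
  where
  zero-tail : ∀ k → coeff (+ 0 ∷ []) k ≡ + 0
  zero-tail zero    = refl
  zero-tail (suc k) = refl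

coeff-mulP-onePlusX-zero : ∀ q → coeff (mulP onePlusX q) zero ≡ coeff q zero
coeff-mulP-onePlusX-zero q =
  trans (coeff-mulP-∷ˡ (+ 1) (+ 1 ∷ []) q zero)
        (trans (ℤ.+-identityʳ _) (ℤ.*-identityˡ (coeff q zero)))

coeff-mulP-onePlusX-suc : ∀ q k → coeff (mulP onePlusX q) (suc k) ≡ coeff q (suc k) ℤ.+ coeff q k
coeff-mulP-onePlusX-suc q k =
  trans (coeff-mulP-∷ˡ (+ 1) (+ 1 ∷ []) q (suc k))
        (cong₂ ℤ._+_ (ℤ.*-identityˡ (coeff q (suc k)))
                     (trans (coeff-mulP-constˡ (+ 1) q k) (ℤ.*-identityˡ (coeff q k))))

coeff-powP-onePlusX : ∀ n k → coeff (powP onePlusX n) k ≡ + (n C k)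
coeff-powP-onePlusX zero    zero    = refl
coeff-powP-onePlusX zero    (suc k) = refl
coeff-powP-onePlusX (suc n) zero    =
  trans (coeff-mulP-onePlusX-zero (powP onePlusX n)) (coeff-powP-onePlusX n zero)
coeff-powP-onePlusX (suc n) (suc k) = begin
  coeff (mulP onePlusX (powP onePlusX n)) (suc k)
    ≡⟨ coeff-mulP-onePlusX-suc (powP onePlusX n) k ⟩
  coeff (powP onePlusX n) (suc k) ℤ.+ coeff (powP onePlusX n) k
    ≡⟨ cong₂ ℤ._+_ (coeff-powP-onePlusX n (suc k)) (coeff-powP-onePlusX n k) ⟩
  + (n C suc k) ℤ.+ + (n C k)
    ≡⟨ ℤ.+-comm (+ (n C suc k)) (+ (n C k)) ⟩
  + (n C k + n C suc k)
    ≡⟨ cong +_ (nCk+nC[k+1]≡[n+1]C[k+1] n k) ⟩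
  + (suc n C suc k) ∎
  where open ≡-Reasoning

coeff-mulP-oneMinusXPow-< : ∀ p m k → k < m → coeff (mulP p (oneMinusXPow m)) k ≡ coeff p k
coeff-mulP-oneMinusXPow-< p m k k<m = begin
  coeff (mulP p (oneMinusXPow m)) k
    ≡⟨ coeff-mulP-addPʳ p (+ 1 ∷ []) _ k ⟩
  coeff (mulP p (+ 1 ∷ [])) k ℤ.+ coeff (mulP p (replicate m (+ 0) ++ -[1+ 0 ] ∷ [])) k
    ≡⟨ cong₂ ℤ._+_ (coeff-mulP-constʳ p (+ 1) k) (coeff-mulP-padʳ-< p _ m k k<m) ⟩
  coeff p k ℤ.* + 1 ℤ.+ + 0
    ≡⟨ trans (ℤ.+-identityʳ _) (ℤ.*-identityʳ _) ⟩
  coeff p k ∎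
  where open ≡-Reasoning

coeff-mulP-oneMinusXPow-+ : ∀ p m j →
  coeff (mulP p (oneMinusXPow m)) (m + j) ≡ coeff p (m + j) ℤ.- coeff p j
coeff-mulP-oneMinusXPow-+ p m j = begin
  coeff (mulP p (oneMinusXPow m)) (m + j)
    ≡⟨ coeff-mulP-addPʳ p (+ 1 ∷ []) _ (m + j) ⟩
  coeff (mulP p (+ 1 ∷ [])) (m + j) ℤ.+ coeff (mulP p (replicate m (+ 0) ++ -[1+ 0 ] ∷ [])) (m + j)
    ≡⟨ cong₂ ℤ._+_ (coeff-mulP-constʳ p (+ 1) (m + j))
                   (trans (coeff-mulP-padʳ-+ p _ m j) (coeff-mulP-constʳ p -[1+ 0 ] j)) ⟩
  coeff p (m + j) ℤ.* + 1 ℤ.+ coeff p j ℤ.* -[1+ 0 ]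
    ≡⟨ minus (coeff p (m + j)) (coeff p j) ⟩
  coeff p (m + j) ℤ.- coeff p j ∎
  where
  open ≡-Reasoning
  minus : ∀ x y → x ℤ.* + 1 ℤ.+ y ℤ.* -[1+ 0 ] ≡ x ℤ.- y
  minus = ℤ-Solver.solve-∀

binArray-oneMinusXPow-< : ∀ m k n → k < m → binArray (oneMinusXPow m) k n ≡ + (n C k)
binArray-oneMinusXPow-< m k n k<m =
  trans (coeff-mulP-oneMinusXPow-< (powP onePlusX n) m k k<m) (coeff-powP-onePlusX n k)

binArray-oneMinusXPow-+ : ∀ m j n →
  binArray (oneMinusXPow m) (m + j) n ≡ + (n C (m + j)) ℤ.- + (n C j)
binArray-oneMinusXPow-+ m j n =
  trans (coeff-mulP-oneMinusXPow-+ (powP onePlusX n) m j)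
        (cong₂ ℤ._-_ (coeff-powP-onePlusX n (m + j)) (coeff-powP-onePlusX n j))

k+l≡n⇒nCk≡nCl : ∀ k l {n} → k + l ≡ n → n C k ≡ n C l
k+l≡n⇒nCk≡nCl k l refl =
  trans (nCk≡nC[n∸k] (m≤m+n k l)) (cong ((k + l) C_) (m+n∸m≡n k l))

[1+k]*[1+n]C[1+k]≡[1+n]*nCk : ∀ n k → suc k * (suc n C suc k) ≡ suc n * (n C k)
[1+k]*[1+n]C[1+k]≡[1+n]*nCk zero    zero    = refl
[1+k]*[1+n]C[1+k]≡[1+n]*nCk zero    (suc k) = ℕ.*-zeroʳ (suc (suc k))
[1+k]*[1+n]C[1+k]≡[1+n]*nCk (suc n) zero    =
  trans (ℕ.+-identityʳ _) (trans (nC1≡n (suc (suc n))) (sym (ℕ.*-identityʳ (suc (suc n)))))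
[1+k]*[1+n]C[1+k]≡[1+n]*nCk (suc n) (suc k) = begin
  suc (suc k) * (suc (suc n) C suc (suc k))
    ≡⟨ cong (suc (suc k) *_) (sym (nCk+nC[k+1]≡[n+1]C[k+1] (suc n) (suc k))) ⟩
  suc (suc k) * (X + Y)
    ≡⟨ split k X Y ⟩
  X + suc k * X + suc (suc k) * Y
    ≡⟨ cong₂ (λ u v → X + u + v) ([1+k]*[1+n]C[1+k]≡[1+n]*nCk n k)
                                 ([1+k]*[1+n]C[1+k]≡[1+n]*nCk n (suc k)) ⟩
  X + suc n * (n C k) + suc n * (n C suc k)
    ≡⟨ merge n X (n C k) (n C suc k) ⟩
  X + suc n * (n C k + n C suc k)
    ≡⟨ cong (λ z → X + suc n * z) (nCk+nC[k+1]≡[n+1]C[k+1] n k) ⟩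
  X + suc n * X
    ≡⟨ collect n X ⟩
  suc (suc n) * X ∎
  where
  open ≡-Reasoning
  X = suc n C suc k
  Y = suc n C suc (suc k)
  split : ∀ k x y → suc (suc k) * (x + y) ≡ x + suc k * x + suc (suc k) * y
  split = ℕ-Solver.solve-∀
  merge : ∀ n x p q → x + suc n * p + suc n * q ≡ x + suc n * (p + q)
  merge = ℕ-Solver.solve-∀
  collect : ∀ n x → x + suc n * x ≡ suc (suc n) * x
  collect = ℕ-Solver.solve-∀

[1+j]*[1+k+j]C[1+j]≡[1+k]*[1+k+j]Cj : ∀ k j →
  suc j * (suc (k + j) C suc j) ≡ suc k * (suc (k + j) C j)
[1+j]*[1+k+j]C[1+j]≡[1+k]*[1+k+j]Cj k j = begin
  suc j * (suc (k + j) C suc j)  ≡⟨ [1+k]*[1+n]C[1+k]≡[1+n]*nCk (k + j) j ⟩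
  suc (k + j) * ((k + j) C j)    ≡⟨ cong (suc (k + j) *_) (k+l≡n⇒nCk≡nCl j k (ℕ.+-comm j k)) ⟩
  suc (k + j) * ((k + j) C k)    ≡⟨ sym ([1+k]*[1+n]C[1+k]≡[1+n]*nCk (k + j) k) ⟩
  suc k * (suc (k + j) C suc k)  ≡⟨ cong (suc k *_) (k+l≡n⇒nCk≡nCl (suc k) j refl) ⟩
  suc k * (suc (k + j) C j)      ∎
  where open ≡-Reasoning

2*[2t+1]Ct≡[2t+2]C[t+1] : ∀ t → 2 * ((2 * t + 1) C t) ≡ (2 * suc t) C suc t
2*[2t+1]Ct≡[2t+2]C[t+1] t = begin
  2 * (n C t)           ≡⟨⟩
  n C t + (n C t + 0)   ≡⟨ cong (λ z → n C t + z) (ℕ.+-identityʳ (n C t)) ⟩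
  n C t + n C t         ≡⟨ cong (λ z → n C t + z) (k+l≡n⇒nCk≡nCl t (suc t) (sum t)) ⟩
  n C t + n C suc t     ≡⟨ nCk+nC[k+1]≡[n+1]C[k+1] n t ⟩
  suc n C suc t         ≡⟨ cong (_C suc t) (double t) ⟩
  (2 * suc t) C suc t   ∎
  where
  open ≡-Reasoning
  n = 2 * t + 1
  sum : ∀ t → t + suc t ≡ 2 * t + 1
  sum = ℕ-Solver.solve-∀
  double : ∀ t → suc (2 * t + 1) ≡ 2 * suc t
  double = ℕ-Solver.solve-∀

m+n⊖m≡n : ∀ m n → (m + n) ⊖ m ≡ + n
m+n⊖m≡n m n = trans (⊖-≥ (m≤m+n m n)) (cong +_ (m+n∸m≡n m n))

m⊖[1+m+n]≡-[1+n] : ∀ m n → m ⊖ suc (m + n) ≡ -[1+ n ]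
m⊖[1+m+n]≡-[1+n] zero    n = refl
m⊖[1+m+n]≡-[1+n] (suc m) n =
  trans ([1+m]⊖[1+n]≡m⊖n m (suc (m + n))) (m⊖[1+m+n]≡-[1+n] m n)

c≡a+b⇒c*[u-v]≡a*u : ∀ a b c u v →
  c ≡ a ℤ.+ b → c ℤ.* v ≡ b ℤ.* u → c ℤ.* (u ℤ.- v) ≡ a ℤ.* u
c≡a+b⇒c*[u-v]≡a*u a b c u v refl cv≡bu = begin
  (a ℤ.+ b) ℤ.* (u ℤ.- v)                  ≡⟨ expand a b u v ⟩
  (a ℤ.+ b) ℤ.* u ℤ.- (a ℤ.+ b) ℤ.* v      ≡⟨ cong (λ z → (a ℤ.+ b) ℤ.* u ℤ.- z) cv≡bu ⟩
  (a ℤ.+ b) ℤ.* u ℤ.- b ℤ.* u              ≡⟨ cancel a b u ⟩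
  a ℤ.* u                                  ∎
  where
  open ≡-Reasoning
  expand : ∀ a b u v → (a ℤ.+ b) ℤ.* (u ℤ.- v) ≡ (a ℤ.+ b) ℤ.* u ℤ.- (a ℤ.+ b) ℤ.* v
  expand = ℤ-Solver.solve-∀
  cancel : ∀ a b u → (a ℤ.+ b) ℤ.* u ℤ.- b ℤ.* u ≡ a ℤ.* u
  cancel = ℤ-Solver.solve-∀

+[1+d]*v≡+n⇒v≡+[n/1+d] : ∀ d n v → + suc d ℤ.* v ≡ + n → v ≡ + (n / suc d)
+[1+d]*v≡+n⇒v≡+[n/1+d] d n (+ x) eq = cong +_ (begin
  x                    ≡⟨ sym (m*n/n≡m x (suc d)) ⟩
  x * suc d / suc d    ≡⟨ cong (_/ suc d) (ℕ.*-comm x (suc d)) ⟩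
  suc d * x / suc d    ≡⟨ cong (_/ suc d) (+-injective (trans (pos-* (suc d) x) eq)) ⟩
  n / suc d            ∎)
  where open ≡-Reasoning

Ballot : ℕ → ℕ → ℕ → Set
Ballot m n k = + suc k ℤ.* binArray (oneMinusXPow m) k n ≡ + m ℤ.* binomℤ n (n ⊖ k)

ballot-beyond : ∀ {m n k} → n < k → k < m → Ballot m n k
ballot-beyond {m} {n} {k} n<k k<m with m≤n⇒∃[o]m+o≡n n<k
... | o , refl = begin
  + suc k ℤ.* binArray (oneMinusXPow m) k n
    ≡⟨ cong (+ suc k ℤ.*_) (binArray-oneMinusXPow-< m k n k<m) ⟩
  + suc k ℤ.* + (n C k)
    ≡⟨ cong (λ z → + suc k ℤ.* + z) (k>n⇒nCk≡0 n<k) ⟩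
  + suc k ℤ.* + 0
    ≡⟨ trans (ℤ.*-zeroʳ (+ suc k)) (sym (ℤ.*-zeroʳ (+ m))) ⟩
  + m ℤ.* binomℤ n -[1+ o ]
    ≡⟨ cong (λ z → + m ℤ.* binomℤ n z) (sym (m⊖[1+m+n]≡-[1+n] n o)) ⟩
  + m ℤ.* binomℤ n (n ⊖ k) ∎
  where open ≡-Reasoning

ballot-diagonal : ∀ k → Ballot (suc k) k k
ballot-diagonal k = begin
  + suc k ℤ.* binArray (oneMinusXPow (suc k)) k k
    ≡⟨ cong (+ suc k ℤ.*_) (binArray-oneMinusXPow-< (suc k) k k (ℕ.n<1+n k)) ⟩
  + suc k ℤ.* + (k C k)
    ≡⟨ cong (λ z → + suc k ℤ.* + z) (nCn≡1 k) ⟩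
  + suc k ℤ.* + 1
    ≡⟨ cong (λ z → + suc k ℤ.* binomℤ k z) (sym (n⊖n≡0 k)) ⟩
  + suc k ℤ.* binomℤ k (k ⊖ k) ∎
  where open ≡-Reasoning

ballot-interior : ∀ m j → Ballot m (suc (m + j + j)) (m + j)
ballot-interior m j = begin
  + suc k ℤ.* binArray (oneMinusXPow m) k n
    ≡⟨ cong (+ suc k ℤ.*_) (binArray-oneMinusXPow-+ m j n) ⟩
  + suc k ℤ.* (+ (n C k) ℤ.- + (n C j))
    ≡⟨ cong (λ z → + suc k ℤ.* (+ z ℤ.- + (n C j))) (k+l≡n⇒nCk≡nCl k (suc j) (+-suc k j)) ⟩
  + suc k ℤ.* (+ (n C suc j) ℤ.- + (n C j))
    ≡⟨ c≡a+b⇒c*[u-v]≡a*u (+ m) (+ suc j) (+ suc k) _ _ suc-k≡m+suc-j absorption ⟩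
  + m ℤ.* + (n C suc j)
    ≡⟨ cong (λ z → + m ℤ.* binomℤ n z) (sym n⊖k≡1+j) ⟩
  + m ℤ.* binomℤ n (n ⊖ k) ∎
  where
  open ≡-Reasoning
  k = m + j
  n = suc (k + j)
  suc-k≡m+suc-j : + suc k ≡ + m ℤ.+ + suc j
  suc-k≡m+suc-j = trans (cong +_ (sym (+-suc m j))) (pos-+ m (suc j))
  absorption : + suc k ℤ.* + (n C j) ≡ + suc j ℤ.* + (n C suc j)
  absorption = begin
    + suc k ℤ.* + (n C j)      ≡⟨ sym (pos-* (suc k) (n C j)) ⟩
    + (suc k * (n C j))        ≡⟨ cong +_ (sym ([1+j]*[1+k+j]C[1+j]≡[1+k]*[1+k+j]Cj k j)) ⟩
    + (suc j * (n C suc j))    ≡⟨ pos-* (suc j) (n C suc j) ⟩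
    + suc j ℤ.* + (n C suc j)  ∎
  n⊖k≡1+j : n ⊖ k ≡ + suc j
  n⊖k≡1+j = trans (cong (_⊖ k) (sym (+-suc k j))) (m+n⊖m≡n k (suc j))

binArray-oneMinusXPow-ballot : ∀ m n k → m + n ≡ 2 * k + 1 → Ballot m n k
binArray-oneMinusXPow-ballot m n k m+n≡2k+1 with <-cmp k n
... | tri< k<n _ _ with m≤n⇒∃[o]m+o≡n k<n
...   | j , refl = subst (λ k → Ballot m (suc (k + j)) k) k≡m+j (ballot-interior m j)
  where
  k≡m+j : m + j ≡ k
  k≡m+j = +-cancelʳ-≡ (suc k) (m + j) k (trans (rearrange m k j) (trans m+n≡2k+1 (double k)))
    where
    rearrange : ∀ m k j → m + j + suc k ≡ m + suc (k + j)
    rearrange = ℕ-Solver.solve-∀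
    double : ∀ k → 2 * k + 1 ≡ k + suc k
    double = ℕ-Solver.solve-∀
binArray-oneMinusXPow-ballot m n k m+n≡2k+1 | tri≈ _ refl _ =
  subst (λ m → Ballot m k k) (sym m≡1+k) (ballot-diagonal k)
  where
  m≡1+k : m ≡ suc k
  m≡1+k = +-cancelʳ-≡ k m (suc k) (trans m+n≡2k+1 (double k))
    where
    double : ∀ k → 2 * k + 1 ≡ suc k + k
    double = ℕ-Solver.solve-∀
binArray-oneMinusXPow-ballot m n k m+n≡2k+1 | tri> _ _ n<k = ballot-beyond n<k k<m
  where
  open ℕ.≤-Reasoning
  double : ∀ k → suc (k + k) ≡ 2 * k + 1
  double = ℕ-Solver.solve-∀
  k<m : k < m
  k<m = ℕ.<⇒≤ (+-cancelʳ-< n (suc k) m (begin-strict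
    suc k + n  ≡⟨ sym (+-suc k n) ⟩
    k + suc n  ≤⟨ ℕ.+-monoʳ-≤ k n<k ⟩
    k + k      <⟨ ℕ.n<1+n (k + k) ⟩
    suc (k + k) ≡⟨ double k ⟩
    2 * k + 1  ≡⟨ sym m+n≡2k+1 ⟩
    m + n      ∎))

binArray-1-x≡catalan : ∀ t → binArray (oneMinusXPow 1) t (2 * t) ≡ + catalan t
binArray-1-x≡catalan t = +[1+d]*v≡+n⇒v≡+[n/1+d] t ((2 * t) C t) _ (begin
  + suc t ℤ.* binArray (oneMinusXPow 1) t (2 * t)
    ≡⟨ binArray-oneMinusXPow-ballot 1 (2 * t) t (ℕ.+-comm 1 (2 * t)) ⟩
  + 1 ℤ.* binomℤ (2 * t) (2 * t ⊖ t)
    ≡⟨ ℤ.*-identityˡ _ ⟩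
  binomℤ (2 * t) (2 * t ⊖ t)
    ≡⟨ cong (binomℤ (2 * t)) 2t⊖t≡t ⟩
  + ((2 * t) C t) ∎)
  where
  open ≡-Reasoning
  2t⊖t≡t : 2 * t ⊖ t ≡ + t
  2t⊖t≡t = trans (m+n⊖m≡n t (t + 0)) (cong +_ (ℕ.+-identityʳ t))

binArray-1-x²≡catalan : ∀ t → binArray (oneMinusXPow 2) (suc t) (2 * t + 1) ≡ + catalan (suc t)
binArray-1-x²≡catalan t = +[1+d]*v≡+n⇒v≡+[n/1+d] (suc t) ((2 * suc t) C suc t) _ (begin
  + suc (suc t) ℤ.* binArray (oneMinusXPow 2) (suc t) n
    ≡⟨ binArray-oneMinusXPow-ballot 2 n (suc t) (sum t) ⟩
  + 2 ℤ.* binomℤ n (n ⊖ suc t)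
    ≡⟨ cong (λ z → + 2 ℤ.* binomℤ n z) n⊖[1+t]≡t ⟩
  + 2 ℤ.* + (n C t)
    ≡⟨ sym (pos-* 2 (n C t)) ⟩
  + (2 * (n C t))
    ≡⟨ cong +_ (2*[2t+1]Ct≡[2t+2]C[t+1] t) ⟩
  + ((2 * suc t) C suc t) ∎)
  where
  open ≡-Reasoning
  n = 2 * t + 1
  sum : ∀ t → 2 + (2 * t + 1) ≡ 2 * suc t + 1
  sum = ℕ-Solver.solve-∀
  split : ∀ t → 2 * t + 1 ≡ suc t + t
  split = ℕ-Solver.solve-∀
  n⊖[1+t]≡t : n ⊖ suc t ≡ + t
  n⊖[1+t]≡t = trans (cong (_⊖ suc t) (split t)) (m+n⊖m≡n (suc t) t)

binArray-oneMinusXPow-odd : ∀ i t →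
  + (t + i + 1) ℤ.* binArray (oneMinusXPow (2 * i + 1)) (i + t) (2 * t)
    ≡ + (2 * i + 1) ℤ.* binomℤ (2 * t) (+ t ℤ.- + i)
binArray-oneMinusXPow-odd i t = begin
  + (t + i + 1) ℤ.* binArray (oneMinusXPow (2 * i + 1)) (i + t) (2 * t)
    ≡⟨ cong (λ z → + z ℤ.* binArray (oneMinusXPow (2 * i + 1)) (i + t) (2 * t)) (shift i t) ⟩
  + suc (i + t) ℤ.* binArray (oneMinusXPow (2 * i + 1)) (i + t) (2 * t)
    ≡⟨ binArray-oneMinusXPow-ballot (2 * i + 1) (2 * t) (i + t) (sum i t) ⟩
  + (2 * i + 1) ℤ.* binomℤ (2 * t) (2 * t ⊖ (i + t))
    ≡⟨ cong (λ z → + (2 * i + 1) ℤ.* binomℤ (2 * t) z) (sym t-i) ⟩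
  + (2 * i + 1) ℤ.* binomℤ (2 * t) (+ t ℤ.- + i) ∎
  where
  open ≡-Reasoning
  shift : ∀ i t → t + i + 1 ≡ suc (i + t)
  shift = ℕ-Solver.solve-∀
  sum : ∀ i t → 2 * i + 1 + 2 * t ≡ 2 * (i + t) + 1
  sum = ℕ-Solver.solve-∀
  double : ∀ t → t + t ≡ 2 * t
  double = ℕ-Solver.solve-∀
  t-i : + t ℤ.- + i ≡ 2 * t ⊖ (i + t)
  t-i = trans ([+m]-[+n]≡m⊖n t i)
       (trans (sym (+-cancelˡ-⊖ t t i)) (cong₂ _⊖_ (double t) (ℕ.+-comm t i)))

binArray-oneMinusXPow-even : ∀ i t →
  + (t + i + 1) ℤ.* binArray (oneMinusXPow (2 * i)) (i + t) (2 * t + 1)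
    ≡ + (2 * i) ℤ.* binomℤ (2 * t + 1) (+ t ℤ.- + i ℤ.+ + 1)
binArray-oneMinusXPow-even i t = begin
  + (t + i + 1) ℤ.* binArray (oneMinusXPow (2 * i)) (i + t) (2 * t + 1)
    ≡⟨ cong (λ z → + z ℤ.* binArray (oneMinusXPow (2 * i)) (i + t) (2 * t + 1)) (shift i t) ⟩
  + suc (i + t) ℤ.* binArray (oneMinusXPow (2 * i)) (i + t) (2 * t + 1)
    ≡⟨ binArray-oneMinusXPow-ballot (2 * i) (2 * t + 1) (i + t) (sum i t) ⟩
  + (2 * i) ℤ.* binomℤ (2 * t + 1) (2 * t + 1 ⊖ (i + t))
    ≡⟨ cong (λ z → + (2 * i) ℤ.* binomℤ (2 * t + 1) z) (sym t-i+1) ⟩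
  + (2 * i) ℤ.* binomℤ (2 * t + 1) (+ t ℤ.- + i ℤ.+ + 1) ∎
  where
  open ≡-Reasoning
  shift : ∀ i t → t + i + 1 ≡ suc (i + t)
  shift = ℕ-Solver.solve-∀
  sum : ∀ i t → 2 * i + (2 * t + 1) ≡ 2 * (i + t) + 1
  sum = ℕ-Solver.solve-∀
  double : ∀ t → t + (t + 1) ≡ 2 * t + 1
  double = ℕ-Solver.solve-∀
  t-i+1 : + t ℤ.- + i ℤ.+ + 1 ≡ 2 * t + 1 ⊖ (i + t)
  t-i+1 = trans (cong (ℤ._+ + 1) ([+m]-[+n]≡m⊖n t i))
         (trans (distribˡ-⊖-+-pos 1 t i)
         (trans (sym (+-cancelˡ-⊖ t (t + 1) i)) (cong₂ _⊖_ (double t) (ℕ.+-comm t i))))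

proposition8p10 :
    ((t : ℕ) → t ≥ 1 → binArray (oneMinusXPow 1) t (2 * t) ≡ + catalan t)
    × ((i t : ℕ) → i ≥ 1 → t ≥ 1 →
        + (t + i + 1) ℤ.* binArray (oneMinusXPow (2 * i + 1)) (i + t) (2 * t)
          ≡ + (2 * i + 1) ℤ.* binomℤ (2 * t) (+ t ℤ.- + i))
    × ((t : ℕ) → binArray (oneMinusXPow 2) (1 + t) (2 * t + 1) ≡ + catalan (suc t))
    × ((i t : ℕ) → i ≥ 1 →
        + (t + i + 1) ℤ.* binArray (oneMinusXPow (2 * i)) (i + t) (2 * t + 1)
          ≡ + (2 * i) ℤ.* binomℤ (2 * t + 1) (+ t ℤ.- + i ℤ.+ + 1))
proposition8p10 =
    (λ t _ → binArray-1-x≡catalan t)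
  , (λ i t _ _ → binArray-oneMinusXPow-odd i t)
  , binArray-1-x²≡catalan
  , (λ i t _ → binArray-oneMinusXPow-even i t)
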